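{- For $n\geq 0$, $$F_n^I(xq,yq^2,q)=q^nF_n^I(x,y,q)\quad\text{and}\quad F_n^I(x,y,q)=q^{\binom{n}{2}}F_n^I\left(x,\frac{y}{q},1\right).$$
   Context: $S_n(123,132,213)$ is the set of permutations of $[n]$ with no subsequence order isomorphic to $123$, $132$ or $213$; each such $\pi$ is a concatenation of increasing blocks of size $1$ or $2$, each block larger than all later blocks. $s(\pi)$, $d(\pi)$ are the numbers of maximal increasing runs of $\pi$ of length $1$ and $2$, and $inv(\pi)$ is the number of inversions. $F_n^I(x,y,q)=\sum_{\pi\in S_n(123,132,213)}x^{s(\pi)}y^{d(\pi)}q^{inv(\pi)}$; $F_n^I(x,y/q,1)$ denotes the result of substituting $y/q$ for $y$ and $1$ for $q$. -}

module Defs where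

open import Data.Nat as N using (ℕ; zero; suc; _<ᵇ_; _≡ᵇ_)
open import Data.Bool using (Bool; true; false; _∧_; _∨_; not; if_then_else_)
open import Data.Bool.Properties using () renaming (_≟_ to _≟ᴮ_)
open import Data.List using (List; []; _∷_; map; concatMap; length; upTo; foldr; _++_; filterᵇ; zipWith)
open import Data.Bool.ListAction using (and; any)
open import Data.Rational using (ℚ; 0ℚ; 1ℚ; _+_; _*_)

_==_ : Bool → Bool → Bool
true  == b = b
false == b = not b

insertions : ℕ → List ℕ → List (List ℕ)
insertions a []      = (a ∷ []) ∷ []
insertions a (b ∷ l) = (a ∷ b ∷ l) ∷ map (b ∷_) (insertions a l)

perms : List ℕ → List (List ℕ)
perms []      = [] ∷ []
perms (a ∷ l) = concatMap (insertions a) (perms l)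

[_] : ℕ → List ℕ
[ n ] = map suc (upTo n)

subs : ℕ → List ℕ → List (List ℕ)
subs zero    _       = [] ∷ []
subs (suc k) []      = []
subs (suc k) (a ∷ l) = map (a ∷_) (subs k l) ++ subs (suc k) l

-- order-isomorphism of two sequences (of distinct entries)
orderIso : List ℕ → List ℕ → Bool
orderIso []      []      = true
orderIso (a ∷ u) (b ∷ v) =
  and (zipWith (λ x y → (a <ᵇ x) == (b <ᵇ y)) u v) ∧ orderIso u v
orderIso _       _       = false

contains : List ℕ → List ℕ → Bool
contains σ π = any (orderIso σ) (subs (length σ) π)

avoids : List ℕ → List ℕ → Bool
avoids σ π = not (contains σ π)

Sn : ℕ → List (List ℕ)
Sn n = filterᵇ (λ π → avoids (1 ∷ 2 ∷ 3 ∷ []) π ∧ avoids (1 ∷ 3 ∷ 2 ∷ []) π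
                       ∧ avoids (2 ∷ 1 ∷ 3 ∷ []) π)
               (perms [ n ])

extendRun : ℕ → List (List ℕ) → List (List ℕ)
extendRun a []              = (a ∷ []) ∷ []
extendRun a ([] ∷ rs)       = (a ∷ []) ∷ [] ∷ rs
extendRun a ((b ∷ r) ∷ rs)  =
  if a <ᵇ b then (a ∷ b ∷ r) ∷ rs else (a ∷ []) ∷ (b ∷ r) ∷ rs

runs : List ℕ → List (List ℕ)
runs []      = []
runs (a ∷ l) = extendRun a (runs l)

sStat : List ℕ → ℕ
sStat π = length (filterᵇ (λ r → length r ≡ᵇ 1) (runs π))

dStat : List ℕ → ℕ
dStat π = length (filterᵇ (λ r → length r ≡ᵇ 2) (runs π))

inv : List ℕ → ℕ
inv []      = 0
inv (a ∷ l) = length (filterᵇ (λ b → b <ᵇ a) l) N.+ inv l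

_^_ : ℚ → ℕ → ℚ
x ^ zero  = 1ℚ
x ^ suc k = x * (x ^ k)

F : ℕ → ℚ → ℚ → ℚ → ℚ
F n x y q = foldr (λ π acc → ((x ^ sStat π) * (y ^ dStat π)) * (q ^ inv π) + acc) 0ℚ (Sn n)

-- A permutation avoiding 123, 132 and 213 has its first entry above every entry from the third
-- position on (otherwise the first, second and that entry would form one of the three patterns).
-- Iterating, it splits into increasing blocks of length 1 or 2, each above everything after it.
-- These blocks are its maximal increasing runs, so s + 2d = n, and every pair of entries is an
-- inversion except the d pairs inside a block, so inv + d = C(n,2). Both identities then hold
-- monomial by monomial: x^s y^d q^inv gains the factor q^(s+2d) = q^n under x ↦ xq, y ↦ yq²,
-- and equals q^(inv+d) x^s (y/q)^d.
module Submission where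

open import Defs
open import Data.Nat using (ℕ)
open import Data.Nat.Combinatorics using (_C_)
open import Data.Product using (_×_)
open import Data.Rational using (ℚ; NonZero; 1ℚ; _*_; 1/_)
open import Relation.Binary.PropositionalEquality using (_≡_)

open import Data.Bool using (true; false; T; not; _∧_)
open import Data.Bool.Properties using (T-∧)
open import Data.Empty using (⊥-elim)
open import Data.List using (List; []; _∷_; map; length; upTo; foldr; filterᵇ)
open import Data.List.Membership.Propositional using (_∈_; lose; find)
open import Data.List.Membership.Propositional.Properties
  using (∈-++⁺ˡ; ∈-++⁺ʳ; ∈-map⁺; ∈-map⁻; ∈-concatMap⁻; ∈-filter⁻)
open import Data.List.Properties using (length-map; length-upTo; filter-all; filter-reject)
open import Data.List.Relation.Binary.Permutation.Propositional
  using (_↭_; ↭-refl; ↭-prep; ↭-swap; ↭-trans; ↭-sym; ↭⇒↭ₛ)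
open import Data.List.Relation.Binary.Permutation.Propositional.Properties using (↭-length)
import Data.List.Relation.Binary.Permutation.Setoid.Properties as Permutationₛ
open import Data.List.Relation.Binary.Sublist.Propositional using (_⊆_; []; _∷_; _∷ʳ_; from∈)
open import Data.List.Relation.Unary.All as All using (All; []; _∷_)
open import Data.List.Relation.Unary.AllPairs as AllPairs using (_∷_)
open import Data.List.Relation.Unary.Any using (here; there)
open import Data.List.Relation.Unary.Any.Properties using (any⁺; any⁻; ++⁺ʳ)
open import Data.List.Relation.Unary.Unique.Propositional using (Unique)
import Data.List.Relation.Unary.Unique.Propositional.Properties as Unique
open import Data.Nat using (zero; suc; _+_; _<_; _<ᵇ_)
import Data.Nat as Nat
open import Data.Nat.Combinatorics using (nC1≡n; nCk+nC[k+1]≡[n+1]C[k+1])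
open import Data.Nat.Properties using (<⇒<ᵇ; <ᵇ⇒<; <-cmp; <-asym; <-trans; +-assoc; suc-injective)
import Data.Nat.Properties as Natₚ
open import Data.Nat.Tactic.RingSolver using (solve-∀)
open import Data.Product using (_,_; proj₁; proj₂; ∃₂)
open import Data.Rational using (0ℚ) renaming (_+_ to _+ℚ_)
open import Data.Rational.Properties
  using (*-identityˡ; *-identityʳ; *-assoc; *-zeroʳ; *-distribˡ-+; *-inverseʳ)
open import Data.Rational.Solver using (module +-*-Solver)
open import Data.Sum using (_⊎_; inj₁; inj₂)
open import Function using (_∘_; Equivalence)
open import Relation.Binary.Definitions using (tri<; tri≈; tri>)
open import Relation.Binary.PropositionalEquality
  using (refl; sym; trans; cong; cong₂; subst; _≢_; setoid; module ≡-Reasoning)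
open import Relation.Nullary using (¬_; contradiction)
open import Relation.Nullary.Decidable using (T?)

Avoids : List ℕ → List ℕ → Set
Avoids σ π = ¬ T (contains σ π)

orderIso⇒length≡ : ∀ σ s → T (orderIso σ s) → length σ ≡ length s
orderIso⇒length≡ []      []      _   = refl
orderIso⇒length≡ (_ ∷ σ) (_ ∷ s) iso =
  cong suc (orderIso⇒length≡ σ s (proj₂ (Equivalence.to T-∧ iso)))

⊆⇒∈subs : ∀ {s π} → s ⊆ π → s ∈ subs (length s) π
⊆⇒∈subs []                 = here refl
⊆⇒∈subs {[]}    (_ ∷ʳ _)   = here refl
⊆⇒∈subs {_ ∷ _} (_ ∷ʳ s⊆π) = ∈-++⁺ʳ _ (⊆⇒∈subs s⊆π)
⊆⇒∈subs (refl ∷ s⊆π)       = ∈-++⁺ˡ (∈-map⁺ _ (⊆⇒∈subs s⊆π))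

contains-⊆ : ∀ σ {s π} → s ⊆ π → T (orderIso σ s) → T (contains σ π)
contains-⊆ σ {s} s⊆π iso rewrite orderIso⇒length≡ σ s iso =
  any⁺ (orderIso σ) (lose (⊆⇒∈subs s⊆π) iso)

contains-∷ : ∀ σ {a π} → T (contains σ π) → T (contains σ (a ∷ π))
contains-∷ []      _ = _
contains-∷ (_ ∷ σ) {a} {π} c =
  any⁺ _ (++⁺ʳ (map (a ∷_) (subs (length σ) π)) (any⁻ _ _ c))

avoids-⊆ : ∀ σ {s π} → Avoids σ π → s ⊆ π → ¬ T (orderIso σ s)
avoids-⊆ σ av s⊆π = av ∘ contains-⊆ σ s⊆π

avoids-∷ : ∀ σ {a π} → Avoids σ (a ∷ π) → Avoids σ π
avoids-∷ σ av = av ∘ contains-∷ σ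

p123 p132 p213 : List ℕ
p123 = 1 ∷ 2 ∷ 3 ∷ []
p132 = 1 ∷ 3 ∷ 2 ∷ []
p213 = 2 ∷ 1 ∷ 3 ∷ []

record Avoider (π : List ℕ) : Set where
  constructor avoider
  field
    avoids-123 : Avoids p123 π
    avoids-132 : Avoids p132 π
    avoids-213 : Avoids p213 π

avoider-∷ : ∀ {a π} → Avoider (a ∷ π) → Avoider π
avoider-∷ {a} {π} (avoider av₁ av₂ av₃) =
  avoider (avoids-∷ p123 {a} {π} av₁) (avoids-∷ p132 {a} {π} av₂) (avoids-∷ p213 {a} {π} av₃)

first<last⇒pattern : ∀ {a c b} → a ≢ c → a < b →
  let w = a ∷ c ∷ b ∷ [] in T (orderIso p123 w) ⊎ T (orderIso p132 w) ⊎ T (orderIso p213 w)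
first<last⇒pattern {a} {c} {b} a≢c a<b with a <ᵇ b | <⇒<ᵇ a<b
... | true | _ with a <ᵇ c in ac | c <ᵇ b in cb
...   | true  | true  = inj₁ _
...   | true  | false = inj₂ (inj₁ _)
...   | false | true  = inj₂ (inj₂ _)
...   | false | false = ⊥-elim (subst T cb (<⇒<ᵇ (<-trans c<a a<b)))
  where
  c<a : c < a
  c<a with <-cmp a c
  ... | tri< a<c _ _ = ⊥-elim (subst T ac (<⇒<ᵇ a<c))
  ... | tri≈ _ a≡c _ = contradiction a≡c a≢c
  ... | tri> _ _ c<a = c<a

avoider-tail-below-head : ∀ {a c l} → Avoider (a ∷ c ∷ l) → a ≢ c → All (a ≢_) l → All (_< a) l
avoider-tail-below-head {a} {c} {l} (avoider av₁ av₂ av₃) a≢c a≢l = All.tabulate below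
  where
  pattern⊆ : ∀ {b} → b ∈ l → a ∷ c ∷ b ∷ [] ⊆ a ∷ c ∷ l
  pattern⊆ b∈l = refl ∷ refl ∷ from∈ b∈l

  below : ∀ {b} → b ∈ l → b < a
  below {b} b∈l with <-cmp b a
  ... | tri< b<a _ _ = b<a
  ... | tri≈ _ b≡a _ = contradiction (sym b≡a) (All.lookup a≢l b∈l)
  ... | tri> _ _ a<b with first<last⇒pattern a≢c a<b
  ...   | inj₁ o        = ⊥-elim (avoids-⊆ p123 av₁ (pattern⊆ b∈l) o)
  ...   | inj₂ (inj₁ o) = ⊥-elim (avoids-⊆ p132 av₂ (pattern⊆ b∈l) o)
  ...   | inj₂ (inj₂ o) = ⊥-elim (avoids-⊆ p213 av₃ (pattern⊆ b∈l) o)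

data BlockDecreasing : List ℕ → Set where
  []     : BlockDecreasing []
  single : ∀ {a l} → All (_< a) l → BlockDecreasing l → BlockDecreasing (a ∷ l)
  pair   : ∀ {a c l} → a < c → All (_< a) l → BlockDecreasing l → BlockDecreasing (a ∷ c ∷ l)

blockDecreasing-∷∷ : ∀ {a c l} → a ≢ c → All (_< a) l →
  BlockDecreasing l → BlockDecreasing (c ∷ l) → BlockDecreasing (a ∷ c ∷ l)
blockDecreasing-∷∷ {a} {c} a≢c l<a l-blocks c∷l-blocks with <-cmp a c
... | tri< a<c _ _ = pair a<c l<a l-blocks
... | tri≈ _ a≡c _ = contradiction a≡c a≢c
... | tri> _ _ c<a = single (c<a ∷ l<a) c∷l-blocks

avoider⇒blockDecreasing : ∀ π → Unique π → Avoider π → BlockDecreasing π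
avoider⇒blockDecreasing []          _ _ = []
avoider⇒blockDecreasing (a ∷ [])    _ _ = single [] []
avoider⇒blockDecreasing (a ∷ c ∷ l) ((a≢c ∷ a≢l) ∷ c∷l-unique) av =
  blockDecreasing-∷∷ a≢c (avoider-tail-below-head av a≢c a≢l)
    (avoider⇒blockDecreasing l (AllPairs.tail c∷l-unique) (avoider-∷ (avoider-∷ av)))
    (avoider⇒blockDecreasing (c ∷ l) c∷l-unique (avoider-∷ av))

extendRun-head : ∀ a R → ∃₂ λ r R′ → extendRun a R ≡ (a ∷ r) ∷ R′
extendRun-head a []            = [] , [] , refl
extendRun-head a ([] ∷ R)      = [] , [] ∷ R , refl
extendRun-head a ((b ∷ r) ∷ R) with a <ᵇ b
... | true  = b ∷ r , R , refl
... | false = [] , (b ∷ r) ∷ R , refl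

extendRun-< : ∀ {a b} r R → a < b → extendRun a ((b ∷ r) ∷ R) ≡ (a ∷ b ∷ r) ∷ R
extendRun-< {a} {b} r R a<b with a <ᵇ b | <⇒<ᵇ a<b
... | true | _ = refl

extendRun-> : ∀ {a b} r R → b < a → extendRun a ((b ∷ r) ∷ R) ≡ (a ∷ []) ∷ (b ∷ r) ∷ R
extendRun-> {a} {b} r R b<a with a <ᵇ b | <ᵇ⇒< a b
... | false | _   = refl
... | true  | a<b = contradiction b<a (<-asym (a<b _))

runs-∷-above : ∀ {a l} → All (_< a) l → runs (a ∷ l) ≡ (a ∷ []) ∷ runs l
runs-∷-above {l = []}    []        = refl
runs-∷-above {a} {b ∷ l} (b<a ∷ _) with extendRun-head b (runs l)
... | r , R , eq = begin
  extendRun a (runs (b ∷ l)) ≡⟨ cong (extendRun a) eq ⟩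
  extendRun a ((b ∷ r) ∷ R)  ≡⟨ extendRun-> r R b<a ⟩
  (a ∷ []) ∷ (b ∷ r) ∷ R     ≡⟨ cong ((a ∷ []) ∷_) eq ⟨
  (a ∷ []) ∷ runs (b ∷ l)    ∎
  where open ≡-Reasoning

All-<-trans : ∀ {a c l} → a < c → All (_< a) l → All (_< c) l
All-<-trans a<c = All.map (λ b<a → <-trans b<a a<c)

runs-pair-above : ∀ {a c l} → a < c → All (_< a) l → runs (a ∷ c ∷ l) ≡ (a ∷ c ∷ []) ∷ runs l
runs-pair-above a<c l<a =
  trans (cong (extendRun _) (runs-∷-above (All-<-trans a<c l<a))) (extendRun-< [] _ a<c)

count-below : ∀ {a l} → All (_< a) l → length (filterᵇ (_<ᵇ a) l) ≡ length l
count-below {a} l<a = cong length (filter-all (T? ∘ (_<ᵇ a)) (All.map <⇒<ᵇ l<a))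

inv-∷-above : ∀ {a l} → All (_< a) l → inv (a ∷ l) ≡ length l + inv l
inv-∷-above {l = l} l<a = cong (_+ inv l) (count-below l<a)

inv-pair-above : ∀ {a c l} → a < c → All (_< a) l → inv (a ∷ c ∷ l) ≡ length l + (length l + inv l)
inv-pair-above {a} {c} {l} a<c l<a = cong₂ _+_ count-c∷l (inv-∷-above (All-<-trans a<c l<a))
  where
  count-c∷l : length (filterᵇ (_<ᵇ a) (c ∷ l)) ≡ length l
  count-c∷l = trans (cong length (filter-reject (T? ∘ (_<ᵇ a)) (<-asym a<c ∘ <ᵇ⇒< c a))) (count-below l<a)

-- sStat π and dStat π unfold to runsOfLength 1 (runs π) and runsOfLength 2 (runs π).
runsOfLength : ℕ → List (List ℕ) → ℕ
runsOfLength k R = length (filterᵇ (λ r → length r Nat.≡ᵇ k) R)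

stats-∷-above : ∀ {a l} → All (_< a) l → sStat (a ∷ l) ≡ suc (sStat l) × dStat (a ∷ l) ≡ dStat l
stats-∷-above l<a = cong (runsOfLength 1) eq , cong (runsOfLength 2) eq
  where eq = runs-∷-above l<a

stats-pair-above : ∀ {a c l} → a < c → All (_< a) l →
  sStat (a ∷ c ∷ l) ≡ sStat l × dStat (a ∷ c ∷ l) ≡ suc (dStat l)
stats-pair-above a<c l<a = cong (runsOfLength 1) eq , cong (runsOfLength 2) eq
  where eq = runs-pair-above a<c l<a

[1+n]C2≡n+nC2 : ∀ n → suc n C 2 ≡ n + n C 2
[1+n]C2≡n+nC2 n = trans (sym (nCk+nC[k+1]≡[n+1]C[k+1] n 1)) (cong (_+ n C 2) (nC1≡n n))

blockDecreasing-size : ∀ {π} → BlockDecreasing π → sStat π + 2 Nat.* dStat π ≡ length π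
blockDecreasing-size [] = refl
blockDecreasing-size (single l<a bl)
  rewrite proj₁ (stats-∷-above l<a) | proj₂ (stats-∷-above l<a) =
    cong suc (blockDecreasing-size bl)
blockDecreasing-size {_ ∷ _ ∷ l} (pair a<c l<a bl)
  rewrite proj₁ (stats-pair-above a<c l<a) | proj₂ (stats-pair-above a<c l<a) =
    trans (regroup (sStat l) (dStat l)) (cong (2 +_) (blockDecreasing-size bl))
  where
  regroup : ∀ s d → s + 2 Nat.* suc d ≡ 2 + (s + 2 Nat.* d)
  regroup = solve-∀

blockDecreasing-inv : ∀ {π} → BlockDecreasing π → inv π + dStat π ≡ length π C 2
blockDecreasing-inv [] = refl
blockDecreasing-inv {a ∷ l} (single l<a bl)
  rewrite inv-∷-above l<a | proj₂ (stats-∷-above l<a) = begin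
    m + inv l + dStat l   ≡⟨ +-assoc m (inv l) (dStat l) ⟩
    m + (inv l + dStat l) ≡⟨ cong (m +_) (blockDecreasing-inv bl) ⟩
    m + m C 2             ≡⟨ [1+n]C2≡n+nC2 m ⟨
    suc m C 2             ∎
  where open ≡-Reasoning; m = length l
blockDecreasing-inv {a ∷ c ∷ l} (pair a<c l<a bl)
  rewrite inv-pair-above a<c l<a | proj₂ (stats-pair-above a<c l<a) = begin
    m + (m + inv l) + suc (dStat l)  ≡⟨ regroup m (inv l) (dStat l) ⟩
    suc m + (m + (inv l + dStat l))  ≡⟨ cong (λ k → suc m + (m + k)) (blockDecreasing-inv bl) ⟩
    suc m + (m + m C 2)              ≡⟨ cong (suc m +_) ([1+n]C2≡n+nC2 m) ⟨
    suc m + suc m C 2                ≡⟨ [1+n]C2≡n+nC2 (suc m) ⟨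
    suc (suc m) C 2                  ∎
  where
  open ≡-Reasoning
  m = length l
  regroup : ∀ m i d → m + (m + i) + suc d ≡ suc m + (m + (i + d))
  regroup = solve-∀

insertions-↭ : ∀ a σ {π} → π ∈ insertions a σ → π ↭ a ∷ σ
insertions-↭ a []      (here refl) = ↭-refl
insertions-↭ a (b ∷ σ) (here refl) = ↭-refl
insertions-↭ a (b ∷ σ) (there π∈) with ∈-map⁻ (b ∷_) π∈
... | _ , π′∈ , refl = ↭-trans (↭-prep b (insertions-↭ a σ π′∈)) (↭-swap b a ↭-refl)

perms-↭ : ∀ l {π} → π ∈ perms l → π ↭ l
perms-↭ []      (here refl) = ↭-refl
perms-↭ (a ∷ l) π∈ with find (∈-concatMap⁻ (insertions a) {xs = perms l} π∈)
... | σ , σ∈ , π∈ins = ↭-trans (insertions-↭ a σ π∈ins) (↭-prep a (perms-↭ l σ∈))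

unique-[n] : ∀ n → Unique [ n ]
unique-[n] n = Unique.map⁺ suc-injective (Unique.upTo⁺ n)

length-[n] : ∀ n → length [ n ] ≡ n
length-[n] n = trans (length-map suc (upTo n)) (length-upTo n)

T-not⇒¬T : ∀ {b} → T (not b) → ¬ T b
T-not⇒¬T {false} _ ()

∈Sn⇒blockDecreasing : ∀ n {π} → π ∈ Sn n → BlockDecreasing π × length π ≡ n
∈Sn⇒blockDecreasing n {π} π∈
  with ∈-filter⁻ (λ π → T? (avoids p123 π ∧ avoids p132 π ∧ avoids p213 π)) {xs = perms [ n ]} π∈
... | π∈perms , avoids-all = avoider⇒blockDecreasing π π-unique π-avoider , π-length
  where
  π↭[n] = perms-↭ [ n ] π∈perms
  π-unique : Unique π
  π-unique = Permutationₛ.Unique-resp-↭ (setoid ℕ) (↭⇒↭ₛ (↭-sym π↭[n])) (unique-[n] n)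
  π-length : length π ≡ n
  π-length = trans (↭-length π↭[n]) (length-[n] n)
  π-avoider : Avoider π
  π-avoider with Equivalence.to T-∧ avoids-all
  ... | av₁ , av₂₃ with Equivalence.to T-∧ av₂₃
  ...   | av₂ , av₃ = avoider (T-not⇒¬T av₁) (T-not⇒¬T av₂) (T-not⇒¬T av₃)

^-zeroˡ : ∀ n → 1ℚ ^ n ≡ 1ℚ
^-zeroˡ zero    = refl
^-zeroˡ (suc n) = trans (*-identityˡ (1ℚ ^ n)) (^-zeroˡ n)

^-distribʳ-* : ∀ x y n → (x * y) ^ n ≡ x ^ n * y ^ n
^-distribʳ-* x y zero    = refl
^-distribʳ-* x y (suc n) = trans (cong ((x * y) *_) (^-distribʳ-* x y n)) (swap-middle x y (x ^ n) (y ^ n))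
  where
  open +-*-Solver using (solve; _:*_; _:=_)
  swap-middle : ∀ a b c d → (a * b) * (c * d) ≡ (a * c) * (b * d)
  swap-middle = solve 4 (λ a b c d → (a :* b) :* (c :* d) := (a :* c) :* (b :* d)) refl

^-distribˡ-+-* : ∀ x m n → x ^ (m + n) ≡ x ^ m * x ^ n
^-distribˡ-+-* x zero    n = sym (*-identityˡ (x ^ n))
^-distribˡ-+-* x (suc m) n = trans (cong (x *_) (^-distribˡ-+-* x m n)) (sym (*-assoc x (x ^ m) (x ^ n)))

^-*-assoc : ∀ x m n → (x ^ m) ^ n ≡ x ^ (m Nat.* n)
^-*-assoc x m zero    = cong (x ^_) (sym (Natₚ.*-zeroʳ m))
^-*-assoc x m (suc n) = begin
  x ^ m * (x ^ m) ^ n     ≡⟨ cong (x ^ m *_) (^-*-assoc x m n) ⟩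
  x ^ m * x ^ (m Nat.* n) ≡⟨ ^-distribˡ-+-* x m (m Nat.* n) ⟨
  x ^ (m + m Nat.* n)     ≡⟨ cong (x ^_) (Natₚ.*-suc m n) ⟨
  x ^ (m Nat.* suc n)     ∎
  where open ≡-Reasoning

sumOver : ∀ {A : Set} → List A → (A → ℚ) → ℚ
sumOver L f = foldr (λ a acc → f a +ℚ acc) 0ℚ L

sumOver-scale : ∀ {A : Set} (L : List A) {f g : A → ℚ} c →
  (∀ {a} → a ∈ L → f a ≡ c * g a) → sumOver L f ≡ c * sumOver L g
sumOver-scale []      c _  = sym (*-zeroʳ c)
sumOver-scale (a ∷ L) {f} {g} c eq = begin
  f a +ℚ sumOver L f             ≡⟨ cong₂ _+ℚ_ (eq (here refl)) (sumOver-scale L c (eq ∘ there)) ⟩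
  c * g a +ℚ c * sumOver L g     ≡⟨ *-distribˡ-+ c (g a) (sumOver L g) ⟨
  c * (g a +ℚ sumOver L g)       ∎
  where open ≡-Reasoning

monomial-rescale : ∀ x y q s d i →
  ((x * q) ^ s * (y * q ^ 2) ^ d) * q ^ i ≡ q ^ (s + 2 Nat.* d) * ((x ^ s * y ^ d) * q ^ i)
monomial-rescale x y q s d i = begin
  ((x * q) ^ s * (y * q ^ 2) ^ d) * q ^ i
    ≡⟨ cong₂ (λ u v → (u * v) * q ^ i) (^-distribʳ-* x q s)
         (trans (^-distribʳ-* y (q ^ 2) d) (cong (y ^ d *_) (^-*-assoc q 2 d))) ⟩
  ((x ^ s * q ^ s) * (y ^ d * q ^ (2 Nat.* d))) * q ^ i
    ≡⟨ regroup (x ^ s) (q ^ s) (y ^ d) (q ^ (2 Nat.* d)) (q ^ i) ⟩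
  (q ^ s * q ^ (2 Nat.* d)) * ((x ^ s * y ^ d) * q ^ i)
    ≡⟨ cong (_* ((x ^ s * y ^ d) * q ^ i)) (^-distribˡ-+-* q s (2 Nat.* d)) ⟨
  q ^ (s + 2 Nat.* d) * ((x ^ s * y ^ d) * q ^ i)
    ∎
  where
  open ≡-Reasoning
  open +-*-Solver using (solve; _:*_; _:=_)
  regroup : ∀ a b c e f → ((a * b) * (c * e)) * f ≡ (b * e) * ((a * c) * f)
  regroup = solve 5 (λ a b c e f → ((a :* b) :* (c :* e)) :* f := (b :* e) :* ((a :* c) :* f)) refl

monomial-dehomogenise : ∀ x y q .{{_ : NonZero q}} s d i →
  (x ^ s * y ^ d) * q ^ i ≡ q ^ (i + d) * ((x ^ s * (y * (1/ q)) ^ d) * 1ℚ ^ i)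
monomial-dehomogenise x y q s d i = sym (begin
  q ^ (i + d) * ((x ^ s * (y * (1/ q)) ^ d) * 1ℚ ^ i)
    ≡⟨ cong₂ (λ u v → u * ((x ^ s * v) * 1ℚ ^ i)) (^-distribˡ-+-* q i d) (^-distribʳ-* y (1/ q) d) ⟩
  (q ^ i * q ^ d) * ((x ^ s * (y ^ d * (1/ q) ^ d)) * 1ℚ ^ i)
    ≡⟨ regroup (q ^ i) (q ^ d) (x ^ s) (y ^ d) ((1/ q) ^ d) (1ℚ ^ i) ⟩
  ((x ^ s * y ^ d) * q ^ i) * ((q ^ d * (1/ q) ^ d) * 1ℚ ^ i)
    ≡⟨ cong₂ (λ u v → ((x ^ s * y ^ d) * q ^ i) * (u * v)) q^d/q^d≡1 (^-zeroˡ i) ⟩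
  ((x ^ s * y ^ d) * q ^ i) * (1ℚ * 1ℚ)
    ≡⟨ *-identityʳ ((x ^ s * y ^ d) * q ^ i) ⟩
  (x ^ s * y ^ d) * q ^ i
    ∎)
  where
  open ≡-Reasoning
  open +-*-Solver using (solve; _:*_; _:=_)
  regroup : ∀ a b c e f g → (a * b) * ((c * (e * f)) * g) ≡ ((c * e) * a) * ((b * f) * g)
  regroup = solve 6 (λ a b c e f g → (a :* b) :* ((c :* (e :* f)) :* g) := ((c :* e) :* a) :* ((b :* f) :* g)) refl
  q^d/q^d≡1 : q ^ d * (1/ q) ^ d ≡ 1ℚ
  q^d/q^d≡1 = begin
    q ^ d * (1/ q) ^ d ≡⟨ ^-distribʳ-* q (1/ q) d ⟨
    (q * (1/ q)) ^ d   ≡⟨ cong (_^ d) (*-inverseʳ q) ⟩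
    1ℚ ^ d             ≡⟨ ^-zeroˡ d ⟩
    1ℚ                 ∎

∈Sn⇒size : ∀ n {π} → π ∈ Sn n → sStat π + 2 Nat.* dStat π ≡ n
∈Sn⇒size n π∈ with ∈Sn⇒blockDecreasing n π∈
... | blocks , length≡n = trans (blockDecreasing-size blocks) length≡n

∈Sn⇒inv+d : ∀ n {π} → π ∈ Sn n → inv π + dStat π ≡ n C 2
∈Sn⇒inv+d n π∈ with ∈Sn⇒blockDecreasing n π∈
... | blocks , length≡n = trans (blockDecreasing-inv blocks) (cong (_C 2) length≡n)

-- F n x y q unfolds to sumOver (Sn n) (weight x y q).
weight : ℚ → ℚ → ℚ → List ℕ → ℚ
weight x y q π = (x ^ sStat π * y ^ dStat π) * q ^ inv π

theorem4p3 : (n : ℕ) →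
    ((x y q : ℚ) → F n (x * q) (y * (q ^ 2)) q ≡ (q ^ n) * F n x y q)
    × ((x y q : ℚ) → .{{_ : NonZero q}} →
         F n x y q ≡ (q ^ (n C 2)) * F n x (y * (1/ q)) 1ℚ)
theorem4p3 n = rescale , dehomogenise
  where
  rescale : (x y q : ℚ) → F n (x * q) (y * (q ^ 2)) q ≡ (q ^ n) * F n x y q
  rescale x y q = sumOver-scale (Sn n) (q ^ n) λ {π} π∈ →
    trans (monomial-rescale x y q (sStat π) (dStat π) (inv π))
          (cong (λ k → q ^ k * weight x y q π) (∈Sn⇒size n π∈))

  dehomogenise : (x y q : ℚ) → .{{_ : NonZero q}} → F n x y q ≡ (q ^ (n C 2)) * F n x (y * (1/ q)) 1ℚ
  dehomogenise x y q = sumOver-scale (Sn n) (q ^ (n C 2)) λ {π} π∈ →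
    trans (monomial-dehomogenise x y q (sStat π) (dStat π) (inv π))
          (cong (λ k → q ^ k * weight x (y * (1/ q)) 1ℚ π) (∈Sn⇒inv+d n π∈))
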